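{- Let $a,b,c\in\mathbb{N}$ with $b\le c$, $2b>c$, $c\ge5$, $b+c\equiv 2\pmod 3$ and $a=(b+c-2)/3$. Let $x=\frac{2}{3}(2b-c-1)$ and $y=\frac23(2c-b-1)$ (even nonnegative integers with $x+y=2a$). Define three lists of length $2a$: First list: $1,1,2,2,\dots,a,a$ (each value twice). Second list: block 1 (length $x$) is $1,2,\dots,x$; block 2 (length $y$) is $x+1$, followed by each of $x+2,\dots,b-1$ twice in increasing order, followed by $x+1$. Third list: block 1 (length $x$, empty if $x=0$) is $1$, followed by each of $2,\dots,x/2$ twice in increasing order, followed by $1$; block 2 (length $y$) is $x/2+1,x/2+2,\dots,c-1$ (each once). For $k\in[2a]$ let $q_k$ be the triple whose entries are the $k$-th entries of the three lists. Then $Q=\{q_1,\dots,q_{2a}\}$ is a feasible strategy for $(a,b,c)$-Mastermind.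
   Context: $[n]=\{1,\dots,n\}$. In $(a,b,c)$-Mastermind, secrets and questions are triples in $[a]\times[b]\times[c]$. $g(s,q)$ is the number of $k\in[3]$ with $s_k=q_k$. A strategy is a set $Q$ of questions; it is feasible if for all distinct secrets $s,s'$ there is $q\in Q$ with $g(s,q)\neq g(s',q)$. -}

module Defs where

open import Data.Nat using (ℕ; zero; suc; _+_; _*_; _∸_; _≤_; _<_; _≡ᵇ_; ⌊_/2⌋)
open import Data.Nat.DivMod using (_/_)
open import Data.Bool using (if_then_else_)
open import Data.Product using (_×_; _,_; Σ-syntax)
open import Data.List using (List; []; _∷_; _++_; applyUpTo; zipWith; [_])
open import Data.List.Membership.Propositional using (_∈_)
open import Relation.Binary.PropositionalEquality using (_≡_)
open import Relation.Nullary using (¬_)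

Triple : Set
Triple = ℕ × ℕ × ℕ

-- [ m .. n ] = m, m+1, ..., n   (empty if n < m)
fromTo : ℕ → ℕ → List ℕ
fromTo m n = applyUpTo (m +_) (suc n ∸ m)

twice : List ℕ → List ℕ
twice []       = []
twice (v ∷ vs) = v ∷ v ∷ twice vs

eqInd : ℕ → ℕ → ℕ
eqInd m n = if m ≡ᵇ n then 1 else 0

g : Triple → Triple → ℕ
g (s₁ , s₂ , s₃) (q₁ , q₂ , q₃) = eqInd s₁ q₁ + eqInd s₂ q₂ + eqInd s₃ q₃

InRange : ℕ → ℕ → ℕ → Triple → Set
InRange a b c (s₁ , s₂ , s₃) =
  (1 ≤ s₁ × s₁ ≤ a) × (1 ≤ s₂ × s₂ ≤ b) × (1 ≤ s₃ × s₃ ≤ c)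

Feasible : ℕ → ℕ → ℕ → List Triple → Set
Feasible a b c Q =
  ((q : Triple) → q ∈ Q → InRange a b c q) ×
  ((s s' : Triple) → InRange a b c s → InRange a b c s' → ¬ (s ≡ s') →
     Σ[ q ∈ Triple ] (q ∈ Q × ¬ (g s q ≡ g s' q)))

xVal : ℕ → ℕ → ℕ
xVal b c = (2 * (2 * b ∸ c ∸ 1)) / 3

yVal : ℕ → ℕ → ℕ
yVal b c = (2 * (2 * c ∸ b ∸ 1)) / 3

list1 : ℕ → List ℕ
list1 a = twice (fromTo 1 a)

list2 : ℕ → ℕ → List ℕ
list2 b c = fromTo 1 x ++ ((x + 1) ∷ twice (fromTo (x + 2) (b ∸ 1)) ++ [ x + 1 ])
  where x = xVal b c

list3block1 : ℕ → List ℕ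
list3block1 zero = []
list3block1 (suc n) = 1 ∷ twice (fromTo 2 ⌊ suc n /2⌋) ++ [ 1 ]

list3 : ℕ → ℕ → List ℕ
list3 b c = list3block1 x ++ fromTo (⌊ x /2⌋ + 1) (c ∸ 1)
  where x = xVal b c

questions : ℕ → ℕ → ℕ → List Triple
questions a b c = zipWith (λ u vw → u , vw) (list1 a) (zipWith _,_ (list2 b c) (list3 b c))

{-# OPTIONS --safe #-}
module Submission where

-- Write a = M + N, b = 2M + N + 1 and c = M + 2N + 1, so that x = 2M and y = 2N. The questions
-- then form two blocks of the same shape: the first M pairs in the coordinates (1, 3, 2), the last N
-- pairs in the coordinates (1, 2, 3) shifted by (M, 2M, M). In a block of length L, pair j consists
-- of (j+1, j+1, 2j+1) and (j+1, j+2, 2j+2), with j+2 read cyclically in [1, L]. Numbering these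
-- questions 1, …, 2L, the first coordinate α of a secret scores at questions 2α-1 and 2α, the second
-- coordinate β at 2β-2 and 2β-1 (question 0 being question 2L), and the third σ at question σ alone.
-- Comparing answers question by question, two secrets that no question of a block distinguishes agree
-- on [1, L] × [1, L] × [1, 2L] as soon as their first coordinates are both in [1, L] or both outside.
-- Their first coordinates cannot lie in different blocks: the parity of the total score of a block
-- (σ counts once, α and β twice) and the structure of the second block (which needs N ≥ 2) exclude it.
-- Each coordinate range is covered by its two windows plus one leftover value, so the secrets are equal.

open import Defs
open import Data.Nat using (ℕ; _+_; _*_; _∸_; _≤_; _<_)
open import Data.Nat.DivMod using (_/_; _%_)
open import Relation.Binary.PropositionalEquality using (_≡_)

open import Data.Nat using (zero; suc; pred; z≤n; s≤s; z<s; _≟_; _≤?_; ⌊_/2⌋)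
open import Data.Nat.Properties
open import Data.Nat.DivMod using (m*n/n≡m; m≡m%n+[m/n]*n)
open import Data.Product using (_×_; _,_; proj₁; proj₂; map₂; ∃-syntax; Σ-syntax)
open import Data.Sum using (_⊎_; inj₁; inj₂)
import Data.Sum as Sum
open import Data.Empty using (⊥; ⊥-elim)
open import Data.List using (List; []; _∷_; _++_; [_]; map; applyUpTo; zipWith)
open import Data.List.Properties using (map-++; map-applyUpTo)
open import Data.List.Membership.Propositional using (_∈_; find)
open import Data.List.Membership.Propositional.Properties using (∈-++⁺ˡ; ∈-++⁺ʳ; ∈-++⁻; ∈-map⁺; ∈-map⁻)
open import Data.List.Relation.Unary.Any using (here; there)
open import Data.List.Relation.Unary.All using (all?)
import Data.List.Relation.Unary.All as All
open import Data.List.Relation.Unary.All.Properties using (¬All⇒Any¬)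
open import Relation.Binary.PropositionalEquality using (_≢_; refl; sym; trans; cong; cong₂; subst; module ≡-Reasoning)
open import Relation.Nullary using (¬_; Dec; yes; no; contradiction; _×-dec_)
open import Function using (_∘_; const)
open import Data.Nat.Tactic.RingSolver using (solve-∀)

cancel₂ : ∀ {a a' b b'} → a ≡ a' → a + b ≡ a' + b' → b ≡ b'
cancel₂ {a} refl = +-cancelˡ-≡ a _ _

cancel₃ : ∀ {a a' b b' c c'} → a ≡ a' → a + b + c ≡ a' + b' + c' → b + c ≡ b' + c'
cancel₃ {a} {a'} {b} {b'} {c} {c'} a≡a' eq =
  cancel₂ a≡a' (trans (sym (+-assoc a b c)) (trans eq (+-assoc a' b' c')))

m+1+0≢m : ∀ m → m + 1 + 0 ≢ m
m+1+0≢m m = m+1+n≢m m ∘ trans (sym (+-assoc m 1 0))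

eqInd-refl : ∀ x → eqInd x x ≡ 1
eqInd-refl zero    = refl
eqInd-refl (suc x) = eqInd-refl x

eqInd-≡ : ∀ {x y} → x ≡ y → eqInd x y ≡ 1
eqInd-≡ {x} refl = eqInd-refl x

eqInd-≢ : ∀ {x y} → x ≢ y → eqInd x y ≡ 0
eqInd-≢ {zero}  {zero}  x≢y = contradiction refl x≢y
eqInd-≢ {zero}  {suc _} _   = refl
eqInd-≢ {suc _} {zero}  _   = refl
eqInd-≢ {suc _} {suc _} x≢y = eqInd-≢ (x≢y ∘ cong suc)

eqInd>0 : ∀ {x y} → x ≡ y → 0 < eqInd x y
eqInd>0 x≡y = ≤-reflexive (sym (eqInd-≡ x≡y))

eqInd>0⇒≡ : ∀ {x y} → 0 < eqInd x y → x ≡ y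
eqInd>0⇒≡ {x} {y} pos with x ≟ y
... | yes x≡y = x≡y
... | no  x≢y = contradiction (eqInd-≢ x≢y) (>⇒≢ pos)

eqInd-cong : ∀ {x y} x' y' → (x ≡ y → x' ≡ y') → (x' ≡ y' → x ≡ y) → eqInd x y ≡ eqInd x' y'
eqInd-cong {x} {y} x' y' to from with x ≟ y
... | yes x≡y = trans (eqInd-≡ x≡y) (sym (eqInd-≡ (to x≡y)))
... | no  x≢y = trans (eqInd-≢ x≢y) (sym (eqInd-≢ (x≢y ∘ from)))

eqInd-∸ : ∀ x k {y} → 1 ≤ y → eqInd x (k + y) ≡ eqInd (x ∸ k) y
eqInd-∸ x       zero    _   = refl
eqInd-∸ zero    (suc k) (s≤s _) = refl
eqInd-∸ (suc x) (suc k) 1≤y = eqInd-∸ x k 1≤y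

g>0⇒hit : ∀ {s₁ s₂ s₃ q₁ q₂ q₃} → 0 < g (s₁ , s₂ , s₃) (q₁ , q₂ , q₃) →
          s₁ ≡ q₁ ⊎ s₂ ≡ q₂ ⊎ s₃ ≡ q₃
g>0⇒hit {s₁} {s₂} {s₃} {q₁} {q₂} {q₃} pos with s₁ ≟ q₁ | s₂ ≟ q₂ | s₃ ≟ q₃
... | yes e | _     | _     = inj₁ e
... | no _  | yes e | _     = inj₂ (inj₁ e)
... | no _  | no _  | yes e = inj₂ (inj₂ e)
... | no n₁ | no n₂ | no n₃ =
  contradiction (cong₂ _+_ (cong₂ _+_ (eqInd-≢ n₁) (eqInd-≢ n₂)) (eqInd-≢ n₃)) (>⇒≢ pos)

InBlock : ℕ → ℕ → Set
InBlock L x = 1 ≤ x × x ≤ L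

inBlock? : ∀ L x → Dec (InBlock L x)
inBlock? L x = 1 ≤? x ×-dec x ≤? L

∉⇒< : ∀ {L x} → 1 ≤ x → ¬ InBlock L x → L < x
∉⇒< 1≤x x∉ = ≰⇒> (λ x≤L → x∉ (1≤x , x≤L))

inBlock-suc : ∀ {L y} → InBlock L y → ∃[ j ] (j < L × suc j ≡ y)
inBlock-suc {y = suc j} (_ , j<L) = j , j<L , refl

∸-∉ : ∀ {k l y} → y ≤ k → ¬ InBlock l (y ∸ k)
∸-∉ y≤k (1≤y∸k , _) = >⇒≢ 1≤y∸k (m≤n⇒m∸n≡0 y≤k)

∸-∈ : ∀ {k l y} → ¬ InBlock k y → InBlock (k + l) y → InBlock l (y ∸ k)
∸-∈ {k} {l} y∉ (1≤y , y≤k+l) =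
  m<n⇒0<n∸m (∉⇒< 1≤y y∉) , ≤-trans (∸-monoˡ-≤ k y≤k+l) (≤-reflexive (m+n∸m≡n k l))

distinct⇒2≤ : ∀ {L i i'} → i < L → i' < L → i ≢ i' → 2 ≤ L
distinct⇒2≤ {i = zero}  {zero}  _             _             i≢i' = contradiction refl i≢i'
distinct⇒2≤ {i = suc _}         (s≤s (s≤s _)) _             _    = s≤s (s≤s z≤n)
distinct⇒2≤ {i = zero}  {suc _} _             (s≤s (s≤s _)) _    = s≤s (s≤s z≤n)

Agree : ℕ → ℕ → ℕ → Set
Agree L x x' = InBlock L x ⊎ InBlock L x' → x ≡ x'

agree-sym : ∀ {L x x'} → Agree L x x' → Agree L x' x
agree-sym agree = sym ∘ agree ∘ Sum.swap

agree-∉ : ∀ {L x x'} → ¬ InBlock L x → ¬ InBlock L x' → Agree L x x'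
agree-∉ x∉ x'∉ = Sum.[ (λ x∈ → contradiction x∈ x∉) , (λ x'∈ → contradiction x'∈ x'∉) ]

agree-eqInd : ∀ {L x x' y} → Agree L x x' → InBlock L y → eqInd x y ≡ eqInd x' y
agree-eqInd {x = x} {x'} {y} agree y∈ with x ≟ y | x' ≟ y
... | yes refl | _        = cong (λ t → eqInd t y) (agree (inj₁ y∈))
... | _        | yes refl = cong (λ t → eqInd t y) (agree (inj₂ y∈))
... | no x≢y   | no x'≢y  = trans (eqInd-≢ x≢y) (sym (eqInd-≢ x'≢y))

-- The windows [1, k] and k + [1, l] cover [1, k + l + 1] except for its top value.
agree-split : ∀ k l {x x'} → Agree k x x' → Agree l (x ∸ k) (x' ∸ k) →
              InBlock (suc (k + l)) x → InBlock (suc (k + l)) x' → x ≡ x'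
agree-split k l {x} {x'} agree₁ agree₂ x∈ x'∈
  with inBlock? k x | inBlock? k x' | inBlock? l (x ∸ k) | inBlock? l (x' ∸ k)
... | yes x∈₁ | _         | _         | _ = agree₁ (inj₁ x∈₁)
... | no _    | yes x'∈₁  | _         | _ = agree₁ (inj₂ x'∈₁)
... | no x∉₁  | no x'∉₁   | yes x∈₂   | _ =
  ∸-cancelʳ-≡ (<⇒≤ (∉⇒< (proj₁ x∈) x∉₁)) (<⇒≤ (∉⇒< (proj₁ x'∈) x'∉₁)) (agree₂ (inj₁ x∈₂))
... | no x∉₁  | no x'∉₁   | no _      | yes x'∈₂ =
  ∸-cancelʳ-≡ (<⇒≤ (∉⇒< (proj₁ x∈) x∉₁)) (<⇒≤ (∉⇒< (proj₁ x'∈) x'∉₁)) (agree₂ (inj₂ x'∈₂))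
... | no x∉₁  | no x'∉₁   | no x∉₂    | no x'∉₂ = trans (top x∈ x∉₁ x∉₂) (sym (top x'∈ x'∉₁ x'∉₂))
  where
  top : ∀ {y} → InBlock (suc (k + l)) y → ¬ InBlock k y → ¬ InBlock l (y ∸ k) → y ≡ suc (k + l)
  top {y} (1≤y , y≤) y∉₁ y∉₂ = ≤-antisym y≤ (begin-strict
    k + l         <⟨ +-monoʳ-< k (∉⇒< (m<n⇒0<n∸m k<y) y∉₂) ⟩
    k + (y ∸ k)   ≡⟨ m+[n∸m]≡n (<⇒≤ k<y) ⟩
    y             ∎)
    where
    open ≤-Reasoning
    k<y = ∉⇒< 1≤y y∉₁

double : ℕ → ℕ
double zero    = zero
double (suc n) = suc (suc (double n))

odd even : ℕ → ℕ
odd  j = suc (double j)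
even j = double (suc j)

double≡+ : ∀ n → double n ≡ n + n
double≡+ zero    = refl
double≡+ (suc n) = cong suc (trans (cong suc (double≡+ n)) (sym (+-suc n n)))

double-injective : ∀ {m n} → double m ≡ double n → m ≡ n
double-injective {zero}  {zero}  _  = refl
double-injective {suc m} {suc n} eq = cong suc (double-injective (suc-injective (suc-injective eq)))

double≢suc-double : ∀ m n → double m ≢ suc (double n)
double≢suc-double (suc m) (suc n) eq = double≢suc-double m n (suc-injective (suc-injective eq))
double≢suc-double (suc zero) zero ()
double≢suc-double (suc (suc m)) zero ()

double-mono-≤ : ∀ {m n} → m ≤ n → double m ≤ double n
double-mono-≤ z≤n       = z≤n
double-mono-≤ (s≤s m≤n) = s≤s (s≤s (double-mono-≤ m≤n))

⌊double/2⌋ : ∀ n → ⌊ double n /2⌋ ≡ n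
⌊double/2⌋ zero    = refl
⌊double/2⌋ (suc n) = cong suc (⌊double/2⌋ n)

parity : ∀ {u v p q} → u ≤ 1 → v ≤ 1 → u + double p ≡ v + double q → u ≡ v
parity z≤n       z≤n       _  = refl
parity (s≤s z≤n) (s≤s z≤n) _  = refl
parity {p = p} {q} z≤n (s≤s z≤n) eq = contradiction eq (double≢suc-double p q)
parity {p = p} {q} (s≤s z≤n) z≤n eq = contradiction (sym eq) (double≢suc-double q p)

odd≢even : ∀ i j → odd i ≢ even j
odd≢even i j eq = double≢suc-double i j (suc-injective eq)

odd-injective : ∀ {i j} → odd i ≡ odd j → i ≡ j
odd-injective = double-injective ∘ suc-injective

even-injective : ∀ {i j} → even i ≡ even j → i ≡ j
even-injective = double-injective ∘ suc-injective ∘ suc-injective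

eqInd-odd : ∀ i j → eqInd (odd i) (odd j) ≡ eqInd i j
eqInd-odd i j = eqInd-cong i j odd-injective (cong odd)

eqInd-even : ∀ i j → eqInd (even i) (even j) ≡ eqInd i j
eqInd-even i j = eqInd-cong i j even-injective (cong even)

odd∈ : ∀ {L j} → j < L → InBlock (double L) (odd j)
odd∈ j<L = z<s , ≤-trans (n≤1+n _) (double-mono-≤ j<L)

even∈ : ∀ {L j} → j < L → InBlock (double L) (even j)
even∈ j<L = z<s , double-mono-≤ j<L

odd-or-even : ∀ {L σ} → InBlock (double L) σ → ∃[ j ] (j < L × (σ ≡ odd j ⊎ σ ≡ even j))
odd-or-even {suc L} {1}                 _                   = 0 , z<s , inj₁ refl
odd-or-even {suc L} {2}                 _                   = 0 , z<s , inj₂ refl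
odd-or-even {suc L} {suc (suc (suc σ))} (_ , s≤s (s≤s σ≤)) with odd-or-even {L} {suc σ} (z<s , σ≤)
... | j , j<L , slot = suc j , s≤s j<L , Sum.map (cong (suc ∘ suc)) (cong (suc ∘ suc)) slot

∑ : ℕ → (ℕ → ℕ) → ℕ
∑ zero    f = 0
∑ (suc n) f = ∑ n f + f n

∑-cong : ∀ n {f h} → (∀ {j} → j < n → f j ≡ h j) → ∑ n f ≡ ∑ n h
∑-cong zero    _   = refl
∑-cong (suc n) f≗h = cong₂ _+_ (∑-cong n (f≗h ∘ m<n⇒m<1+n)) (f≗h (n<1+n n))

∑-+ : ∀ n f h → ∑ n (λ j → f j + h j) ≡ ∑ n f + ∑ n h
∑-+ zero    f h = refl
∑-+ (suc n) f h = trans (cong (_+ (f n + h n)) (∑-+ n f h)) (interchange (∑ n f) (∑ n h) (f n) (h n))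
  where
  interchange : ∀ a b c d → a + b + (c + d) ≡ a + c + (b + d)
  interchange = solve-∀

∑-head : ∀ n f → ∑ (suc n) f ≡ f 0 + ∑ n (f ∘ suc)
∑-head zero    f = +-comm 0 (f 0)
∑-head (suc n) f = trans (cong (_+ f (suc n)) (∑-head n f)) (+-assoc (f 0) _ _)

χ : ℕ → ℕ → ℕ
χ L x = ∑ L (λ j → eqInd x (suc j))

χ-∉ : ∀ {L x} → ¬ InBlock L x → χ L x ≡ 0
χ-∉ {zero}  _   = refl
χ-∉ {suc L} {x} x∉ =
  cong₂ _+_ (χ-∉ {L} (x∉ ∘ map₂ m≤n⇒m≤1+n)) (eqInd-≢ {x} {suc L} (λ { refl → x∉ (z<s , ≤-refl) }))

χ-∈ : ∀ {L x} → InBlock L x → χ L x ≡ 1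
χ-∈ {zero}  (s≤s _ , ())
χ-∈ {suc L} {x} (1≤x , x≤1+L) with m≤n⇒m<n∨m≡n x≤1+L
... | inj₁ x<1+L = cong₂ _+_ (χ-∈ {L} (1≤x , ≤-pred x<1+L)) (eqInd-≢ (<⇒≢ x<1+L))
... | inj₂ refl  = cong₂ _+_ (χ-∉ {L} (λ (_ , x≤L) → 1+n≰n x≤L)) (eqInd-refl (suc L))

χ≤1 : ∀ L x → χ L x ≤ 1
χ≤1 L x with inBlock? L x
... | yes x∈ = ≤-reflexive (χ-∈ {L} x∈)
... | no  x∉ = ≤-trans (≤-reflexive (χ-∉ {L} x∉)) z≤n

χ-double : ∀ L x → ∑ L (λ j → eqInd x (odd j) + eqInd x (even j)) ≡ χ (double L) x
χ-double zero    x = refl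
χ-double (suc L) x = trans (cong (_+ (eqInd x (odd L) + eqInd x (even L))) (χ-double L x))
                           (sym (+-assoc (χ (double L) x) (eqInd x (odd L)) (eqInd x (even L))))

infix 5 _until_then_
_until_then_ : (ℕ → ℕ) → ℕ → ℕ → ℕ → ℕ
(h until zero  then w) _       = w
(h until suc K then w) zero    = h 0
(h until suc K then w) (suc j) = ((h ∘ suc) until K then w) j

until-< : ∀ h K w {j} → j < K → (h until K then w) j ≡ h j
until-< h (suc K) w {zero}  _         = refl
until-< h (suc K) w {suc j} (s≤s j<K) = until-< (h ∘ suc) K w j<K

until-≡ : ∀ h K w → (h until K then w) K ≡ w
until-≡ h zero    w = refl
until-≡ h (suc K) w = until-≡ (h ∘ suc) K w

-- cyclicSuc L j = j + 2 for j < L - 1, and cyclicSuc L (L - 1) = 1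
cyclicSuc : ℕ → ℕ → ℕ
cyclicSuc L = (suc ∘ suc) until pred L then 1

cyclicSuc-view : ∀ {K j} → j < suc K →
  (j < K × cyclicSuc (suc K) j ≡ suc (suc j)) ⊎ (j ≡ K × cyclicSuc (suc K) j ≡ 1)
cyclicSuc-view {K} (s≤s j≤K) with m≤n⇒m<n∨m≡n j≤K
... | inj₁ j<K = inj₁ (j<K , until-< (suc ∘ suc) K 1 j<K)
... | inj₂ refl = inj₂ (refl , until-≡ (suc ∘ suc) K 1)

cyclicSuc-∈ : ∀ {L j} → j < L → InBlock L (cyclicSuc L j)
cyclicSuc-∈ {suc K} j<L with cyclicSuc-view j<L
... | inj₁ (j<K , eq) = subst (InBlock (suc K)) (sym eq) (z<s , s≤s j<K)
... | inj₂ (_ , eq)   = subst (InBlock (suc K)) (sym eq) (z<s , s≤s z≤n)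

cyclicSuc-injective : ∀ {L i j} → i < L → j < L → cyclicSuc L i ≡ cyclicSuc L j → i ≡ j
cyclicSuc-injective {suc K} i<L j<L eq with cyclicSuc-view i<L | cyclicSuc-view j<L
... | inj₁ (_ , ei) | inj₁ (_ , ej) = suc-injective (suc-injective (trans (sym ei) (trans eq ej)))
... | inj₁ (_ , ei) | inj₂ (_ , ej) = contradiction (trans (sym ei) (trans eq ej)) λ ()
... | inj₂ (_ , ei) | inj₁ (_ , ej) = contradiction (trans (sym ei) (trans eq ej)) λ ()
... | inj₂ (i≡K , _) | inj₂ (j≡K , _) = trans i≡K (sym j≡K)

cyclicSuc-surjective : ∀ {L y} → InBlock L y → ∃[ j ] (j < L × cyclicSuc L j ≡ y)
cyclicSuc-surjective {suc K} {suc zero}    _             = K , ≤-refl , until-≡ (suc ∘ suc) K 1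
cyclicSuc-surjective {suc K} {suc (suc j)} (_ , s≤s j<K) =
  j , m<n⇒m<1+n j<K , until-< (suc ∘ suc) K 1 j<K

cyclicSuc≢suc : ∀ {L j} → 2 ≤ L → j < L → cyclicSuc L j ≢ suc j
cyclicSuc≢suc {suc K} 2≤L j<L with cyclicSuc-view j<L
... | inj₁ (_ , eq)    = 1+n≢n ∘ suc-injective ∘ trans (sym eq)
... | inj₂ (refl , eq) = λ eq' → <⇒≢ 2≤L (sym (trans (sym eq') eq))

χ-cyclicSuc : ∀ L x → ∑ L (λ j → eqInd x (cyclicSuc L j)) ≡ χ L x
χ-cyclicSuc zero    x = refl
χ-cyclicSuc (suc K) x = begin
  ∑ K (λ j → eqInd x (cyclicSuc (suc K) j)) + eqInd x (cyclicSuc (suc K) K)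
    ≡⟨ cong₂ _+_ (∑-cong K (λ j<K → cong (eqInd x) (until-< (suc ∘ suc) K 1 j<K)))
                 (cong (eqInd x) (until-≡ (suc ∘ suc) K 1)) ⟩
  ∑ K (λ j → eqInd x (suc (suc j))) + eqInd x 1
    ≡⟨ +-comm _ (eqInd x 1) ⟩
  eqInd x 1 + ∑ K (λ j → eqInd x (suc (suc j)))
    ≡⟨ sym (∑-head K (λ j → eqInd x (suc j))) ⟩
  χ (suc K) x ∎
  where open ≡-Reasoning

record Indistinguishable (Q : List Triple) (s s' : Triple) : Set where
  constructor indist
  field same-answer : ∀ {q} → q ∈ Q → g s q ≡ g s' q
open Indistinguishable

indist-sym : ∀ {Q s s'} → Indistinguishable Q s s' → Indistinguishable Q s' s
indist-sym same = indist (sym ∘ same-answer same)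

indist-hit : ∀ {Q s₁ s₂ s₃ s'₁ s'₂ s'₃ q₁ q₂ q₃} →
             Indistinguishable Q (s₁ , s₂ , s₃) (s'₁ , s'₂ , s'₃) → (q₁ , q₂ , q₃) ∈ Q → s₁ ≡ q₁ →
             s'₁ ≡ q₁ ⊎ s'₂ ≡ q₂ ⊎ s'₃ ≡ q₃
indist-hit {s₂ = s₂} {q₂ = q₂} same q∈ s₁≡q₁ =
  g>0⇒hit (subst (0 <_) (same-answer same q∈)
                 (≤-trans (eqInd>0 s₁≡q₁) (≤-trans (m≤m+n _ (eqInd s₂ q₂)) (m≤m+n _ _))))

indist-++ˡ : ∀ {Q R s s'} → Indistinguishable (Q ++ R) s s' → Indistinguishable Q s s'
indist-++ˡ same = indist (same-answer same ∘ ∈-++⁺ˡ)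

indist-++ʳ : ∀ Q {R s s'} → Indistinguishable (Q ++ R) s s' → Indistinguishable R s s'
indist-++ʳ Q same = indist (same-answer same ∘ ∈-++⁺ʳ Q)

indist-map : ∀ {Q s s'} {f h : Triple → Triple} → (∀ {q} → q ∈ Q → ∀ t → g t (f q) ≡ g (h t) q) →
             Indistinguishable (map f Q) s s' → Indistinguishable Q (h s) (h s')
indist-map {s = s} {s'} {f} f↝h same =
  indist λ q∈ → trans (sym (f↝h q∈ s)) (trans (same-answer same (∈-map⁺ f q∈)) (f↝h q∈ s'))

distinguish : ∀ {Q s s'} → ¬ Indistinguishable Q s s' → Σ[ q ∈ Triple ] (q ∈ Q × ¬ (g s q ≡ g s' q))
distinguish {Q} {s} {s'} ¬same with all? (λ q → g s q ≟ g s' q) Q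
... | yes all = contradiction (indist (All.lookup all)) ¬same
... | no ¬all = find (¬All⇒Any¬ (λ q → g s q ≟ g s' q) Q ¬all)

feasible-intro : ∀ {a b c Q} → (∀ q → q ∈ Q → InRange a b c q) →
  (∀ {s s'} → InRange a b c s → InRange a b c s' → Indistinguishable Q s s' → s ≡ s') → Feasible a b c Q
feasible-intro inRange separates = inRange , λ s s' s∈ s'∈ s≢s' → distinguish (s≢s' ∘ separates s∈ s'∈)

-- One block of questions

interleave : {A : Set} → ℕ → (ℕ → A) → (ℕ → A) → List A
interleave zero    f h = []
interleave (suc L) f h = f 0 ∷ h 0 ∷ interleave L (f ∘ suc) (h ∘ suc)

∈-interleaveˡ : ∀ {A : Set} {L} {f h : ℕ → A} {j} → j < L → f j ∈ interleave L f h
∈-interleaveˡ {L = suc L} {j = zero}  _         = here refl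
∈-interleaveˡ {L = suc L} {j = suc j} (s≤s j<L) = there (there (∈-interleaveˡ j<L))

∈-interleaveʳ : ∀ {A : Set} {L} {f h : ℕ → A} {j} → j < L → h j ∈ interleave L f h
∈-interleaveʳ {L = suc L} {j = zero}  _         = there (here refl)
∈-interleaveʳ {L = suc L} {j = suc j} (s≤s j<L) = there (there (∈-interleaveʳ j<L))

∈-interleave⁻ : ∀ {A : Set} L {f h : ℕ → A} {x} → x ∈ interleave L f h →
                ∃[ j ] (j < L × (x ≡ f j ⊎ x ≡ h j))
∈-interleave⁻ (suc L) (here eq)         = 0 , z<s , inj₁ eq
∈-interleave⁻ (suc L) (there (here eq)) = 0 , z<s , inj₂ eq
∈-interleave⁻ (suc L) (there (there x∈)) with ∈-interleave⁻ L x∈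
... | j , j<L , eq = suc j , s≤s j<L , eq

oddQ : ℕ → Triple
oddQ j = suc j , suc j , odd j

evenQ : ℕ → ℕ → Triple
evenQ L j = suc j , cyclicSuc L j , even j

block : ℕ → List Triple
block L = interleave L oddQ (evenQ L)

block-inRange : ∀ {L q} → q ∈ block L → InRange L L (double L) q
block-inRange {L} q∈ with ∈-interleave⁻ L q∈
... | j , j<L , inj₁ refl = (z<s , j<L) , (z<s , j<L) , odd∈ j<L
... | j , j<L , inj₂ refl = (z<s , j<L) , cyclicSuc-∈ j<L , even∈ j<L

block-total : ∀ L α β σ →
  ∑ L (λ j → g (α , β , σ) (oddQ j) + g (α , β , σ) (evenQ L j)) ≡ χ (double L) σ + double (χ L α + χ L β)
block-total L α β σ = begin
  ∑ L (λ j → g (α , β , σ) (oddQ j) + g (α , β , σ) (evenQ L j))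
    ≡⟨ ∑-cong L (λ {j} _ → regroup (eqInd α (suc j)) (eqInd β (suc j)) (eqInd σ (odd j))
                                    (eqInd β (cyclicSuc L j)) (eqInd σ (even j))) ⟩
  ∑ L (λ j → (eqInd σ (odd j) + eqInd σ (even j))
             + ((eqInd α (suc j) + eqInd β (suc j)) + (eqInd α (suc j) + eqInd β (cyclicSuc L j))))
    ≡⟨ ∑-+ L _ _ ⟩
  ∑ L (λ j → eqInd σ (odd j) + eqInd σ (even j))
    + ∑ L (λ j → (eqInd α (suc j) + eqInd β (suc j)) + (eqInd α (suc j) + eqInd β (cyclicSuc L j)))
    ≡⟨ cong₂ _+_ (χ-double L σ) (trans (∑-+ L _ _) (cong₂ _+_ (∑-+ L _ _)
                   (trans (∑-+ L _ _) (cong (χ L α +_) (χ-cyclicSuc L β))))) ⟩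
  χ (double L) σ + ((χ L α + χ L β) + (χ L α + χ L β))
    ≡⟨ cong (χ (double L) σ +_) (sym (double≡+ (χ L α + χ L β))) ⟩
  χ (double L) σ + double (χ L α + χ L β) ∎
  where
  open ≡-Reasoning
  regroup : ∀ a b c b' c' → a + b + c + (a + b' + c') ≡ c + c' + (a + b + (a + b'))
  regroup = solve-∀

-- Each block answers σ-hits once and α- and β-hits twice, so the parity of its total score
-- tells whether σ lies in [1, 2L].
indist-σ∉ : ∀ {L α β σ α' β' σ'} → Indistinguishable (block L) (α , β , σ) (α' , β' , σ') →
            ¬ InBlock (double L) σ' → ¬ InBlock (double L) σ
indist-σ∉ {L} {α} {β} {σ} {α'} {β'} {σ'} same σ'∉ σ∈ = 1+n≢0 (begin
  1                 ≡⟨ sym (χ-∈ {double L} σ∈) ⟩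
  χ (double L) σ    ≡⟨ parity (χ≤1 (double L) σ) (χ≤1 (double L) σ') totals ⟩
  χ (double L) σ'   ≡⟨ χ-∉ {double L} σ'∉ ⟩
  0                 ∎)
  where
  open ≡-Reasoning
  totals : χ (double L) σ + double (χ L α + χ L β) ≡ χ (double L) σ' + double (χ L α' + χ L β')
  totals = trans (sym (block-total L α β σ))
                 (trans (∑-cong L (λ j<L → cong₂ _+_ (same-answer same (∈-interleaveˡ j<L)) (same-answer same (∈-interleaveʳ j<L))))
                        (block-total L α' β' σ'))

odd-βσ : ∀ {L α β σ α' β' σ' j} → Indistinguishable (block L) (α , β , σ) (α' , β' , σ') →
         Agree L α α' → j < L → eqInd β (suc j) + eqInd σ (odd j) ≡ eqInd β' (suc j) + eqInd σ' (odd j)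
odd-βσ same agα j<L = cancel₃ (agree-eqInd agα (z<s , j<L)) (same-answer same (∈-interleaveˡ j<L))

even-βσ : ∀ {L α β σ α' β' σ' j} → Indistinguishable (block L) (α , β , σ) (α' , β' , σ') →
          Agree L α α' → j < L →
          eqInd β (cyclicSuc L j) + eqInd σ (even j) ≡ eqInd β' (cyclicSuc L j) + eqInd σ' (even j)
even-βσ same agα j<L = cancel₃ (agree-eqInd agα (z<s , j<L)) (same-answer same (∈-interleaveʳ j<L))

-- If β' ≠ β = i + 1, then σ' has to score at question 2i+1 in place of β', and nothing of s'
-- scores at the other question 2i of β.
indist-β : ∀ {L α β σ α' β' σ'} → Indistinguishable (block L) (α , β , σ) (α' , β' , σ') →
           Agree L α α' → InBlock L β → β ≡ β'
indist-β {L} {β = suc i} {σ} {β' = β'} {σ'} same agα (s≤s z≤n , i<L) with suc i ≟ β'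
... | yes β≡β' = β≡β'
... | no  β≢β' = ⊥-elim (1+n≢0 (begin
  1 + eqInd σ (even j)                              ≡⟨ cong (_+ eqInd σ (even j)) (sym (eqInd-≡ (sym cyc≡))) ⟩
  eqInd (suc i) (cyclicSuc L j) + eqInd σ (even j)  ≡⟨ even-βσ same agα j<L ⟩
  eqInd β' (cyclicSuc L j) + eqInd σ' (even j)      ≡⟨ cong₂ _+_ (eqInd-≢ (λ β'≡cyc → β≢β' (sym (trans β'≡cyc cyc≡))))
                                                                 (eqInd-≢ (odd≢even i j ∘ trans (sym σ'≡odd))) ⟩
  0                                                 ∎))
  where
  open ≡-Reasoning
  σ'≡odd : σ' ≡ odd i
  σ'≡odd = eqInd>0⇒≡ (subst (0 <_) (trans (odd-βσ same agα i<L) (cong (_+ eqInd σ' (odd i)) (eqInd-≢ (β≢β' ∘ sym))))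
                                   (≤-trans (eqInd>0 {i} refl) (m≤m+n _ (eqInd σ (odd i)))))
  preimage = cyclicSuc-surjective (z<s , i<L)
  j = proj₁ preimage
  j<L = proj₁ (proj₂ preimage)
  cyc≡ = proj₂ (proj₂ preimage)

cancel-hit : ∀ {u u'} c σ' → u ≡ u' → u + eqInd c c ≡ u' + eqInd σ' c → c ≡ σ'
cancel-hit c σ' u≡u' eq = sym (eqInd>0⇒≡ (subst (0 <_) (cancel₂ u≡u' eq) (eqInd>0 {c} refl)))

indist-σ : ∀ {L α β σ α' β' σ'} → Indistinguishable (block L) (α , β , σ) (α' , β' , σ') →
           Agree L α α' → Agree L β β' → InBlock (double L) σ → σ ≡ σ'
indist-σ {σ' = σ'} same agα agβ σ∈ with odd-or-even σ∈
... | j , j<L , inj₁ refl = cancel-hit (odd j) σ' (agree-eqInd agβ (z<s , j<L)) (odd-βσ same agα j<L)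
... | j , j<L , inj₂ refl = cancel-hit (even j) σ' (agree-eqInd agβ (cyclicSuc-∈ j<L)) (even-βσ same agα j<L)

-- (β , σ) covers the two questions 2i+1, 2i+2 at which α = i+1 scores
Covers : ℕ → ℕ → ℕ → ℕ → Set
Covers L i β σ = (β ≡ suc i × σ ≡ even i) ⊎ (β ≡ cyclicSuc L i × σ ≡ odd i)

covered : ∀ {L i β σ α' β' σ'} → 2 ≤ L → Indistinguishable (block L) (suc i , β , σ) (α' , β' , σ') →
          i < L → α' ≢ suc i → Covers L i β' σ'
covered {i = i} 2≤L same i<L α'≢ with indist-hit same (∈-interleaveˡ i<L) refl
                                     | indist-hit same (∈-interleaveʳ i<L) refl
... | inj₁ α'≡           | _                   = contradiction α'≡ α'≢
... | _                  | inj₁ α'≡            = contradiction α'≡ α'≢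
... | inj₂ (inj₁ β'≡suc) | inj₂ (inj₁ β'≡cyc)  = contradiction (trans (sym β'≡cyc) β'≡suc) (cyclicSuc≢suc 2≤L i<L)
... | inj₂ (inj₁ β'≡suc) | inj₂ (inj₂ σ'≡even) = inj₁ (β'≡suc , σ'≡even)
... | inj₂ (inj₂ σ'≡odd) | inj₂ (inj₁ β'≡cyc)  = inj₂ (β'≡cyc , σ'≡odd)
... | inj₂ (inj₂ σ'≡odd) | inj₂ (inj₂ σ'≡even) = contradiction (trans (sym σ'≡odd) σ'≡even) (odd≢even i i)

covers-even : ∀ {L i β σ j} → Covers L i β σ → i < L → j < L → cyclicSuc L j ≢ suc i →
              eqInd β (cyclicSuc L j) + eqInd σ (even j) ≡ eqInd i j
covers-even {i = i} {j = j} (inj₁ (refl , refl)) _ _ cyc≢ =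
  cong₂ _+_ (eqInd-≢ (cyc≢ ∘ sym)) (eqInd-even i j)
covers-even {L} {i} {j = j} (inj₂ (refl , refl)) i<L j<L _ =
  trans (cong₂ _+_ (eqInd-cong i j (cyclicSuc-injective i<L j<L) (cong (cyclicSuc L))) (eqInd-≢ (odd≢even i j)))
        (+-identityʳ _)

covers-odd : ∀ {L i β σ j} → Covers L i β σ → suc j ≢ cyclicSuc L i →
             eqInd β (suc j) + eqInd σ (odd j) ≡ eqInd i j
covers-odd {i = i} {j = j} (inj₁ (refl , refl)) _ =
  trans (cong (eqInd i j +_) (eqInd-≢ (odd≢even j i ∘ sym))) (+-identityʳ _)
covers-odd {i = i} {j = j} (inj₂ (refl , refl)) suc≢ = cong₂ _+_ (eqInd-≢ (suc≢ ∘ sym)) (eqInd-odd i j)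

-- The (β , σ) of the first secret covers the questions 2i'+1, 2i'+2 and one neighbour of them
-- (2i' or 2i'+3), where the second secret scores one less.
covers-disjoint : ∀ {L i i' β σ β' σ'} → 2 ≤ L → i < L → i' < L → i ≢ i' →
  Indistinguishable (block L) (suc i , β , σ) (suc i' , β' , σ') → Covers L i β' σ' → Covers L i' β σ → ⊥
covers-disjoint {L} {i} {i'} {β' = β'} {σ'} 2≤L i<L i'<L i≢i' same cov' (inj₁ (refl , refl)) =
  m+1+0≢m (eqInd i j) (begin
    eqInd i j + 1 + 0
      ≡⟨ sym (cong₂ _+_ (cong (eqInd i j +_) (eqInd-≡ (sym cyc≡)))
                        (eqInd-≢ (j≢i' ∘ sym ∘ even-injective))) ⟩
    g (suc i , suc i' , even i') (evenQ L j)
      ≡⟨ same-answer same (∈-interleaveʳ j<L) ⟩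
    g (suc i' , β' , σ') (evenQ L j)
      ≡⟨ cong (λ t → t + eqInd β' (cyclicSuc L j) + eqInd σ' (even j)) (eqInd-≢ (j≢i' ∘ sym ∘ suc-injective)) ⟩
    eqInd β' (cyclicSuc L j) + eqInd σ' (even j)
      ≡⟨ covers-even cov' i<L j<L (λ cyc≡suc → i≢i' (suc-injective (trans (sym cyc≡suc) cyc≡))) ⟩
    eqInd i j ∎)
  where
  open ≡-Reasoning
  preimage = cyclicSuc-surjective (z<s , i'<L)
  j = proj₁ preimage
  j<L = proj₁ (proj₂ preimage)
  cyc≡ = proj₂ (proj₂ preimage)
  j≢i' : j ≢ i'
  j≢i' j≡i' = cyclicSuc≢suc 2≤L i'<L (subst (λ k → cyclicSuc L k ≡ suc i') j≡i' cyc≡)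
covers-disjoint {L} {i} {i'} {β' = β'} {σ'} 2≤L i<L i'<L i≢i' same cov' (inj₂ (refl , refl)) =
  m+1+0≢m (eqInd i j) (begin
    eqInd i j + 1 + 0
      ≡⟨ sym (cong₂ _+_ (cong (eqInd i j +_) (eqInd-≡ (sym suc≡)))
                        (eqInd-≢ (j≢i' ∘ sym ∘ odd-injective))) ⟩
    g (suc i , cyclicSuc L i' , odd i') (oddQ j)
      ≡⟨ same-answer same (∈-interleaveˡ j<L) ⟩
    g (suc i' , β' , σ') (oddQ j)
      ≡⟨ cong (λ t → t + eqInd β' (suc j) + eqInd σ' (odd j)) (eqInd-≢ (j≢i' ∘ sym ∘ suc-injective)) ⟩
    eqInd β' (suc j) + eqInd σ' (odd j)
      ≡⟨ covers-odd {L} cov' (λ suc≡cyc → i≢i' (cyclicSuc-injective i<L i'<L (trans (sym suc≡cyc) suc≡))) ⟩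
    eqInd i j ∎)
  where
  open ≡-Reasoning
  predecessor = inBlock-suc (cyclicSuc-∈ i'<L)
  j = proj₁ predecessor
  j<L = proj₁ (proj₂ predecessor)
  suc≡ = proj₂ (proj₂ predecessor)
  j≢i' : j ≢ i'
  j≢i' j≡i' = cyclicSuc≢suc 2≤L i'<L (sym (subst (λ k → suc k ≡ cyclicSuc L i') j≡i' suc≡))

indist-α : ∀ {L α β σ α' β' σ'} → Indistinguishable (block L) (α , β , σ) (α' , β' , σ') →
           InBlock L α → InBlock L α' → α ≡ α'
indist-α {α = suc i} {α' = suc i'} same (s≤s z≤n , i<L) (s≤s z≤n , i'<L) with i ≟ i'
... | yes i≡i' = cong suc i≡i'
... | no  i≢i' = ⊥-elim (covers-disjoint 2≤L i<L i'<L i≢i' same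
                           (covered 2≤L same i<L (i≢i' ∘ sym ∘ suc-injective))
                           (covered 2≤L (indist-sym same) i'<L (i≢i' ∘ suc-injective)))
  where 2≤L = distinct⇒2≤ i<L i'<L i≢i'

indist-agree : ∀ {L α β σ α' β' σ'} → Indistinguishable (block L) (α , β , σ) (α' , β' , σ') →
               Agree L α α' → Agree L β β' × Agree (double L) σ σ'
indist-agree {L} {β = β} {σ} {β' = β'} {σ'} same agα = agβ , agσ
  where
  agβ : Agree L β β'
  agβ = Sum.[ indist-β same agα , sym ∘ indist-β (indist-sym same) (agree-sym agα) ]
  agσ : Agree (double L) σ σ'
  agσ = Sum.[ indist-σ same agα agβ , sym ∘ indist-σ (indist-sym same) (agree-sym agα) (agree-sym agβ) ]

indist-α∈⇒β'∈ : ∀ {L α β σ α' β' σ'} → Indistinguishable (block L) (α , β , σ) (α' , β' , σ') →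
                InBlock L α → ¬ InBlock L α' → InBlock L β'
indist-α∈⇒β'∈ {α = suc i} same (s≤s z≤n , i<L) α'∉ with indist-hit same (∈-interleaveˡ i<L) refl
                                                      | indist-hit same (∈-interleaveʳ i<L) refl
... | inj₁ refl          | _                   = contradiction (z<s , i<L) α'∉
... | _                  | inj₁ refl           = contradiction (z<s , i<L) α'∉
... | inj₂ (inj₁ refl)   | _                   = z<s , i<L
... | _                  | inj₂ (inj₁ refl)    = cyclicSuc-∈ i<L
... | inj₂ (inj₂ σ'≡odd) | inj₂ (inj₂ σ'≡even) = contradiction (trans (sym σ'≡odd) σ'≡even) (odd≢even i i)

indist-α-switch : ∀ {L α β σ α' β' σ'} → 2 ≤ L → Indistinguishable (block L) (α , β , σ) (α' , β' , σ') →
                  ¬ InBlock L α → InBlock L α' → ¬ InBlock (double L) σ → ⊥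
indist-α-switch {α' = suc i} 2≤L same α∉ (s≤s z≤n , i<L) σ∉
  with indist-hit (indist-sym same) (∈-interleaveˡ i<L) refl | indist-hit (indist-sym same) (∈-interleaveʳ i<L) refl
... | inj₁ refl          | _                  = α∉ (z<s , i<L)
... | _                  | inj₁ refl          = α∉ (z<s , i<L)
... | inj₂ (inj₂ refl)   | _                  = σ∉ (odd∈ i<L)
... | _                  | inj₂ (inj₂ refl)   = σ∉ (even∈ i<L)
... | inj₂ (inj₁ β≡suc)  | inj₂ (inj₁ β≡cyc)  = cyclicSuc≢suc 2≤L i<L (trans (sym β≡cyc) β≡suc)

-- Two blocks

swap₂₃ : Triple → Triple
swap₂₃ (x , y , z) = x , z , y

_⊕_ : Triple → Triple → Triple
(k₁ , k₂ , k₃) ⊕ (q₁ , q₂ , q₃) = k₁ + q₁ , k₂ + q₂ , k₃ + q₃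

_⊖_ : Triple → Triple → Triple
(s₁ , s₂ , s₃) ⊖ (k₁ , k₂ , k₃) = s₁ ∸ k₁ , s₂ ∸ k₂ , s₃ ∸ k₃

g-swap₂₃ : ∀ s q → g s (swap₂₃ q) ≡ g (swap₂₃ s) q
g-swap₂₃ (s₁ , s₂ , s₃) (q₁ , q₂ , q₃) = right-comm (eqInd s₁ q₁) (eqInd s₂ q₃) (eqInd s₃ q₂)
  where
  right-comm : ∀ a b c → a + b + c ≡ a + c + b
  right-comm = solve-∀

g-⊕ : ∀ {a b c} s k q → InRange a b c q → g s (k ⊕ q) ≡ g (s ⊖ k) q
g-⊕ (s₁ , s₂ , s₃) (k₁ , k₂ , k₃) (q₁ , q₂ , q₃) ((1≤q₁ , _) , (1≤q₂ , _) , (1≤q₃ , _)) =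
  cong₂ _+_ (cong₂ _+_ (eqInd-∸ s₁ k₁ 1≤q₁) (eqInd-∸ s₂ k₂ 1≤q₂)) (eqInd-∸ s₃ k₃ 1≤q₃)

inRange-mono : ∀ {a b c a' b' c' q} → a ≤ a' → b ≤ b' → c ≤ c' → InRange a b c q → InRange a' b' c' q
inRange-mono a≤ b≤ c≤ ((l₁ , u₁) , (l₂ , u₂) , (l₃ , u₃)) =
  (l₁ , ≤-trans u₁ a≤) , (l₂ , ≤-trans u₂ b≤) , (l₃ , ≤-trans u₃ c≤)

inRange-swap₂₃ : ∀ {a b c q} → InRange a b c q → InRange a c b (swap₂₃ q)
inRange-swap₂₃ (r₁ , r₂ , r₃) = r₁ , r₃ , r₂

inRange-⊕ : ∀ {a b c q} k → InRange a b c q →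
            InRange (proj₁ k + a) (proj₁ (proj₂ k) + b) (proj₂ (proj₂ k) + c) (k ⊕ q)
inRange-⊕ (k₁ , k₂ , k₃) ((l₁ , u₁) , (l₂ , u₂) , (l₃ , u₃)) =
  shift k₁ l₁ u₁ , shift k₂ l₂ u₂ , shift k₃ l₃ u₃
  where
  shift : ∀ {n x} k → 1 ≤ x → x ≤ n → InBlock (k + n) (k + x)
  shift k 1≤x x≤n = ≤-trans 1≤x (m≤n+m _ k) , +-monoʳ-≤ k x≤n

offset : ℕ → Triple
offset M = M , double M , M

twoBlocks : ℕ → ℕ → List Triple
twoBlocks M N = map swap₂₃ (block M) ++ map (offset M ⊕_) (block N)

twoBlocks-inRange : ∀ M N {q} → q ∈ twoBlocks M N → InRange (M + N) (suc (double M + N)) (suc (M + double N)) q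
twoBlocks-inRange M N q∈ with ∈-++⁻ (map swap₂₃ (block M)) q∈
... | inj₁ q∈₁ with ∈-map⁻ swap₂₃ q∈₁
...   | q , q∈block , refl = inRange-mono (m≤m+n M N) (≤-trans (m≤m+n (double M) N) (n≤1+n _))
                                          (≤-trans (m≤m+n M (double N)) (n≤1+n _))
                                          (inRange-swap₂₃ (block-inRange q∈block))
twoBlocks-inRange M N q∈ | inj₂ q∈₂ with ∈-map⁻ (offset M ⊕_) q∈₂
...   | q , q∈block , refl = inRange-mono ≤-refl (n≤1+n _) (n≤1+n _) (inRange-⊕ (offset M) (block-inRange q∈block))

blocks-of : ∀ {M N x y z x' y' z'} → Indistinguishable (twoBlocks M N) (x , y , z) (x' , y' , z') →
  Indistinguishable (block M) (x , z , y) (x' , z' , y') ×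
  Indistinguishable (block N) (x ∸ M , y ∸ double M , z ∸ M) (x' ∸ M , y' ∸ double M , z' ∸ M)
blocks-of {M} same =
  indist-map {h = swap₂₃} (λ _ t → g-swap₂₃ t _) (indist-++ˡ same) ,
  indist-map {h = _⊖ offset M} (λ q∈ t → g-⊕ t (offset M) _ (block-inRange q∈)) (indist-++ʳ (map swap₂₃ (block M)) same)

-- The first block puts z' into [1, M], so s' has no σ-hit in the second block, and by parity
-- neither has s.
no-crossing : ∀ {M N x y z x' y' z'} → 2 ≤ N →
  Indistinguishable (twoBlocks M N) (x , y , z) (x' , y' , z') →
  InBlock M x → ¬ InBlock M x' → InBlock (M + N) x' → ⊥
no-crossing 2≤N same x∈₁ x'∉₁ x'∈ =
  let first , second = blocks-of same
      z'∈₁ = indist-α∈⇒β'∈ first x∈₁ x'∉₁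
  in indist-α-switch 2≤N second (∸-∉ (proj₂ x∈₁)) (∸-∈ x'∉₁ x'∈) (indist-σ∉ second (∸-∉ (proj₂ z'∈₁)))

first-coordinate-agrees : ∀ {M N x y z x' y' z'} → 2 ≤ N →
  Indistinguishable (twoBlocks M N) (x , y , z) (x' , y' , z') →
  InBlock (M + N) x → InBlock (M + N) x' → Agree M x x' × Agree N (x ∸ M) (x' ∸ M)
first-coordinate-agrees {M} {x = x} {x' = x'} 2≤N same x∈ x'∈ with inBlock? M x | inBlock? M x'
... | yes x∈₁ | yes x'∈₁ = const (indist-α (proj₁ (blocks-of same)) x∈₁ x'∈₁) ,
                           agree-∉ (∸-∉ (proj₂ x∈₁)) (∸-∉ (proj₂ x'∈₁))
... | no  x∉₁ | no  x'∉₁ = agree-∉ x∉₁ x'∉₁ ,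
                           const (indist-α (proj₂ (blocks-of same)) (∸-∈ x∉₁ x∈) (∸-∈ x'∉₁ x'∈))
... | yes x∈₁ | no  x'∉₁ = ⊥-elim (no-crossing 2≤N same x∈₁ x'∉₁ x'∈)
... | no  x∉₁ | yes x'∈₁ = ⊥-elim (no-crossing 2≤N (indist-sym same) x'∈₁ x∉₁ x∈)

twoBlocks-separate : ∀ {M N} → 2 ≤ N → ∀ {s s'} →
  InRange (M + N) (suc (double M + N)) (suc (M + double N)) s →
  InRange (M + N) (suc (double M + N)) (suc (M + double N)) s' →
  Indistinguishable (twoBlocks M N) s s' → s ≡ s'
twoBlocks-separate {M} {N} 2≤N {x , y , z} {x' , y' , z'} (x∈ , y∈ , z∈) (x'∈ , y'∈ , z'∈) same =
  let first , second = blocks-of same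
      agx₁ , agx₂ = first-coordinate-agrees 2≤N same x∈ x'∈
      agz₁ , agy₁ = indist-agree first agx₁
      agy₂ , agz₂ = indist-agree second agx₂
  in cong₂ _,_ (agree-split M N agx₁ agx₂ (map₂ m≤n⇒m≤1+n x∈) (map₂ m≤n⇒m≤1+n x'∈))
               (cong₂ _,_ (agree-split (double M) N agy₁ agy₂ y∈ y'∈)
                          (agree-split M (double N) agz₁ agz₂ z∈ z'∈))

-- The question lists

map-interleave : ∀ {A B : Set} (k : A → B) L f h → map k (interleave L f h) ≡ interleave L (k ∘ f) (k ∘ h)
map-interleave k zero    f h = refl
map-interleave k (suc L) f h = cong (λ l → k (f 0) ∷ k (h 0) ∷ l) (map-interleave k L (f ∘ suc) (h ∘ suc))

zipWith-interleave-++ : ∀ {A B C : Set} (k : A → B → C) L f h f' h' xs ys →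
  zipWith k (interleave L f h ++ xs) (interleave L f' h' ++ ys) ≡
  interleave L (λ j → k (f j) (f' j)) (λ j → k (h j) (h' j)) ++ zipWith k xs ys
zipWith-interleave-++ k zero    f h f' h' xs ys = refl
zipWith-interleave-++ k (suc L) f h f' h' xs ys =
  cong (λ l → k (f 0) (f' 0) ∷ k (h 0) (h' 0) ∷ l) (zipWith-interleave-++ k L (f ∘ suc) (h ∘ suc) (f' ∘ suc) (h' ∘ suc) xs ys)

zipWith-interleave : ∀ {A B C : Set} (k : A → B → C) L f h f' h' →
  zipWith k (interleave L f h) (interleave L f' h') ≡ interleave L (λ j → k (f j) (f' j)) (λ j → k (h j) (h' j))
zipWith-interleave k zero    f h f' h' = refl
zipWith-interleave k (suc L) f h f' h' =
  cong (λ l → k (f 0) (f' 0) ∷ k (h 0) (h' 0) ∷ l) (zipWith-interleave k L (f ∘ suc) (h ∘ suc) (f' ∘ suc) (h' ∘ suc))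

zipWith-twoBlocks : ∀ {A B C : Set} (k : A → B → C) M N f h f' h' u v u' v' →
  zipWith k (interleave M f h ++ interleave N u v) (interleave M f' h' ++ interleave N u' v') ≡
  interleave M (λ j → k (f j) (f' j)) (λ j → k (h j) (h' j)) ++ interleave N (λ j → k (u j) (u' j)) (λ j → k (v j) (v' j))
zipWith-twoBlocks k M N f h f' h' u v u' v' =
  trans (zipWith-interleave-++ k M f h f' h' _ _) (cong (_ ++_) (zipWith-interleave k N u v u' v'))

twice-++ : ∀ xs ys → twice (xs ++ ys) ≡ twice xs ++ twice ys
twice-++ []       ys = refl
twice-++ (x ∷ xs) ys = cong (λ l → x ∷ x ∷ l) (twice-++ xs ys)

map-twice : ∀ f xs → map f (twice xs) ≡ twice (map f xs)
map-twice f []       = refl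
map-twice f (x ∷ xs) = cong (λ l → f x ∷ f x ∷ l) (map-twice f xs)

twice-applyUpTo : ∀ f L → twice (applyUpTo f L) ≡ interleave L f f
twice-applyUpTo f zero    = refl
twice-applyUpTo f (suc L) = cong (λ l → f 0 ∷ f 0 ∷ l) (twice-applyUpTo (f ∘ suc) L)

applyUpTo-double : ∀ {A : Set} (f : ℕ → A) L → applyUpTo f (double L) ≡ interleave L (f ∘ double) (f ∘ odd)
applyUpTo-double f zero    = refl
applyUpTo-double f (suc L) = cong (λ l → f 0 ∷ f 1 ∷ l) (applyUpTo-double (f ∘ suc ∘ suc) L)

applyUpTo-+ : ∀ {A : Set} (f : ℕ → A) m n → applyUpTo f (m + n) ≡ applyUpTo f m ++ applyUpTo (λ j → f (m + j)) n
applyUpTo-+ f zero    n = refl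
applyUpTo-+ f (suc m) n = cong (f 0 ∷_) (applyUpTo-+ (f ∘ suc) m n)

applyUpTo-cong : ∀ {A : Set} {f h : ℕ → A} → (∀ j → f j ≡ h j) → ∀ n → applyUpTo f n ≡ applyUpTo h n
applyUpTo-cong f≗h zero    = refl
applyUpTo-cong f≗h (suc n) = cong₂ _∷_ (f≗h 0) (applyUpTo-cong (f≗h ∘ suc) n)

fromTo-+ : ∀ d m n → fromTo (d + m) (d + n) ≡ map (d +_) (fromTo m n)
fromTo-+ d m n = begin
  applyUpTo (d + m +_) (suc (d + n) ∸ (d + m))
    ≡⟨ cong (applyUpTo (d + m +_)) (trans (cong (_∸ (d + m)) (sym (+-suc d n))) ([m+n]∸[m+o]≡n∸o d (suc n) m)) ⟩
  applyUpTo (d + m +_) (suc n ∸ m)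
    ≡⟨ applyUpTo-cong (+-assoc d m) (suc n ∸ m) ⟩
  applyUpTo (λ j → d + (m + j)) (suc n ∸ m)
    ≡⟨ sym (map-applyUpTo (m +_) (d +_) (suc n ∸ m)) ⟩
  map (d +_) (fromTo m n) ∎
  where open ≡-Reasoning

twice-wrap : ∀ K f w → f 0 ∷ twice (applyUpTo (f ∘ suc) K) ++ [ w ] ≡ interleave (suc K) f ((f ∘ suc) until K then w)
twice-wrap zero    f w = refl
twice-wrap (suc K) f w = cong (λ l → f 0 ∷ f 1 ∷ l) (twice-wrap K (f ∘ suc) w)

cycle-list : ∀ d K → (d + 1) ∷ twice (fromTo (d + 2) (d + suc K)) ++ [ d + 1 ] ≡
                     interleave (suc K) (λ j → d + suc j) (λ j → d + cyclicSuc (suc K) j)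
cycle-list d K = begin
  (d + 1) ∷ twice (fromTo (d + 2) (d + suc K)) ++ [ d + 1 ]
    ≡⟨ cong (λ l → (d + 1) ∷ twice l ++ [ d + 1 ]) (fromTo-+ d 2 (suc K)) ⟩
  (d + 1) ∷ twice (map (d +_) (fromTo 2 (suc K))) ++ [ d + 1 ]
    ≡⟨ cong (λ l → (d + 1) ∷ l ++ [ d + 1 ]) (sym (map-twice (d +_) (fromTo 2 (suc K)))) ⟩
  (d + 1) ∷ map (d +_) (twice (fromTo 2 (suc K))) ++ map (d +_) [ 1 ]
    ≡⟨ cong ((d + 1) ∷_) (sym (map-++ (d +_) (twice (fromTo 2 (suc K))) [ 1 ])) ⟩
  map (d +_) (1 ∷ twice (fromTo 2 (suc K)) ++ [ 1 ])
    ≡⟨ cong (map (d +_)) (twice-wrap K suc 1) ⟩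
  map (d +_) (interleave (suc K) suc (cyclicSuc (suc K)))
    ≡⟨ map-interleave (d +_) (suc K) suc (cyclicSuc (suc K)) ⟩
  interleave (suc K) (λ j → d + suc j) (λ j → d + cyclicSuc (suc K) j) ∎
  where open ≡-Reasoning

xVal-param : ∀ M N → xVal (suc (double M + N)) (suc (M + double N)) ≡ double M
xVal-param M N = begin
  2 * (2 * suc (double M + N) ∸ suc (M + double N) ∸ 1) / 3
    ≡⟨ cong (λ t → 2 * (t ∸ suc (M + double N) ∸ 1) / 3) two-b ⟩
  2 * (suc (3 * M) + suc (M + double N) ∸ suc (M + double N) ∸ 1) / 3
    ≡⟨ cong (λ t → 2 * (t ∸ 1) / 3) (m+n∸n≡m (suc (3 * M)) (suc (M + double N))) ⟩
  2 * (3 * M) / 3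
    ≡⟨ cong (_/ 3) (six-M M) ⟩
  (M + M) * 3 / 3
    ≡⟨ m*n/n≡m (M + M) 3 ⟩
  M + M
    ≡⟨ sym (double≡+ M) ⟩
  double M ∎
  where
  open ≡-Reasoning
  six-M : ∀ M → 2 * (3 * M) ≡ (M + M) * 3
  six-M = solve-∀
  two-b-+ : ∀ M N → 2 * suc (M + M + N) ≡ suc (3 * M) + suc (M + (N + N))
  two-b-+ = solve-∀
  two-b : 2 * suc (double M + N) ≡ suc (3 * M) + suc (M + double N)
  two-b = begin
    2 * suc (double M + N)            ≡⟨ cong (λ t → 2 * suc (t + N)) (double≡+ M) ⟩
    2 * suc (M + M + N)               ≡⟨ two-b-+ M N ⟩
    suc (3 * M) + suc (M + (N + N))   ≡⟨ cong (λ t → suc (3 * M) + suc (M + t)) (sym (double≡+ N)) ⟩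
    suc (3 * M) + suc (M + double N)  ∎

list1-shape : ∀ M N → list1 (M + N) ≡ interleave M suc suc ++ interleave N (λ j → M + suc j) (λ j → M + suc j)
list1-shape M N = begin
  twice (applyUpTo suc (M + N))
    ≡⟨ cong twice (trans (applyUpTo-+ suc M N) (cong (applyUpTo suc M ++_) (applyUpTo-cong (sym ∘ +-suc M) N))) ⟩
  twice (applyUpTo suc M ++ applyUpTo (λ j → M + suc j) N)
    ≡⟨ twice-++ (applyUpTo suc M) _ ⟩
  twice (applyUpTo suc M) ++ twice (applyUpTo (λ j → M + suc j) N)
    ≡⟨ cong₂ _++_ (twice-applyUpTo suc M) (twice-applyUpTo (λ j → M + suc j) N) ⟩
  interleave M suc suc ++ interleave N (λ j → M + suc j) (λ j → M + suc j) ∎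
  where open ≡-Reasoning

list2-shape : ∀ M K → list2 (suc (double M + suc K)) (suc (M + double (suc K))) ≡
  interleave M odd even ++ interleave (suc K) (λ j → double M + suc j) (λ j → double M + cyclicSuc (suc K) j)
list2-shape M K = begin
  fromTo 1 x ++ ((x + 1) ∷ twice (fromTo (x + 2) (double M + suc K)) ++ [ x + 1 ])
    ≡⟨ cong (λ t → fromTo 1 t ++ ((t + 1) ∷ twice (fromTo (t + 2) (double M + suc K)) ++ [ t + 1 ]))
            (xVal-param M (suc K)) ⟩
  fromTo 1 (double M) ++ ((double M + 1) ∷ twice (fromTo (double M + 2) (double M + suc K)) ++ [ double M + 1 ])
    ≡⟨ cong₂ _++_ (applyUpTo-double suc M) (cycle-list (double M) K) ⟩
  interleave M odd even ++ interleave (suc K) (λ j → double M + suc j) (λ j → double M + cyclicSuc (suc K) j) ∎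
  where
  open ≡-Reasoning
  x = xVal (suc (double M + suc K)) (suc (M + double (suc K)))

list3block1-double : ∀ M → list3block1 (double M) ≡ interleave M suc (cyclicSuc M)
list3block1-double zero    = refl
list3block1-double (suc K) =
  trans (cong (λ n → 1 ∷ twice (fromTo 2 (suc n)) ++ [ 1 ]) (⌊double/2⌋ K)) (cycle-list 0 K)

list3-shape : ∀ M N → list3 (suc (double M + N)) (suc (M + double N)) ≡
  interleave M suc (cyclicSuc M) ++ interleave N (λ j → M + odd j) (λ j → M + even j)
list3-shape M N = begin
  list3block1 x ++ fromTo (⌊ x /2⌋ + 1) (M + double N)
    ≡⟨ cong (λ t → list3block1 t ++ fromTo (⌊ t /2⌋ + 1) (M + double N)) (xVal-param M N) ⟩
  list3block1 (double M) ++ fromTo (⌊ double M /2⌋ + 1) (M + double N)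
    ≡⟨ cong₂ _++_ (list3block1-double M) (cong (λ m → fromTo (m + 1) (M + double N)) (⌊double/2⌋ M)) ⟩
  interleave M suc (cyclicSuc M) ++ fromTo (M + 1) (M + double N)
    ≡⟨ cong (interleave M suc (cyclicSuc M) ++_) (fromTo-+ M 1 (double N)) ⟩
  interleave M suc (cyclicSuc M) ++ map (M +_) (applyUpTo suc (double N))
    ≡⟨ cong (λ l → interleave M suc (cyclicSuc M) ++ map (M +_) l) (applyUpTo-double suc N) ⟩
  interleave M suc (cyclicSuc M) ++ map (M +_) (interleave N odd even)
    ≡⟨ cong (interleave M suc (cyclicSuc M) ++_) (map-interleave (M +_) N odd even) ⟩
  interleave M suc (cyclicSuc M) ++ interleave N (λ j → M + odd j) (λ j → M + even j) ∎
  where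
  open ≡-Reasoning
  x = xVal (suc (double M + N)) (suc (M + double N))

questions-twoBlocks : ∀ M K →
  questions (M + suc K) (suc (double M + suc K)) (suc (M + double (suc K))) ≡ twoBlocks M (suc K)
questions-twoBlocks M K = begin
  zipWith (λ u vw → u , vw) (list1 (M + N)) (zipWith _,_ (list2 b c) (list3 b c))
    ≡⟨ cong₂ (zipWith (λ u vw → u , vw)) (list1-shape M N)
             (trans (cong₂ (zipWith _,_) (list2-shape M K) (list3-shape M N))
                    (zipWith-twoBlocks _,_ M N odd even suc (cyclicSuc M)
                                       (λ j → double M + suc j) (λ j → double M + cyclicSuc N j)
                                       (λ j → M + odd j) (λ j → M + even j))) ⟩
  zipWith (λ u vw → u , vw) (interleave M suc suc ++ interleave N (λ j → M + suc j) (λ j → M + suc j))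
                            (interleave M (λ j → odd j , suc j) (λ j → even j , cyclicSuc M j) ++
                             interleave N (λ j → double M + suc j , M + odd j) (λ j → double M + cyclicSuc N j , M + even j))
    ≡⟨ zipWith-twoBlocks (λ u vw → u , vw) M N suc suc (λ j → odd j , suc j) (λ j → even j , cyclicSuc M j)
                         (λ j → M + suc j) (λ j → M + suc j)
                         (λ j → double M + suc j , M + odd j) (λ j → double M + cyclicSuc N j , M + even j) ⟩
  interleave M (swap₂₃ ∘ oddQ) (swap₂₃ ∘ evenQ M) ++ interleave N ((offset M ⊕_) ∘ oddQ) ((offset M ⊕_) ∘ evenQ N)
    ≡⟨ sym (cong₂ _++_ (map-interleave swap₂₃ M oddQ (evenQ M)) (map-interleave (offset M ⊕_) N oddQ (evenQ N))) ⟩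
  twoBlocks M N ∎
  where
  open ≡-Reasoning
  N = suc K
  b = suc (double M + N)
  c = suc (M + double N)

-- The parameters M and N

%3≡2⇒≡2+a*3 : ∀ {a} s → s % 3 ≡ 2 → a ≡ (s ∸ 2) / 3 → s ≡ 2 + a * 3
%3≡2⇒≡2+a*3 {a} s s%3≡2 a≡ = trans s≡2+q*3 (cong (λ q → 2 + q * 3) (sym a≡q))
  where
  s≡2+q*3 : s ≡ 2 + s / 3 * 3
  s≡2+q*3 = trans (m≡m%n+[m/n]*n s 3) (cong (_+ s / 3 * 3) s%3≡2)
  a≡q : a ≡ s / 3
  a≡q = trans a≡ (trans (cong (λ t → (t ∸ 2) / 3) s≡2+q*3) (m*n/n≡m (s / 3) 3))

b+c≡2+a*3⇒a<b : ∀ {a b c} → c < 2 * b → b + c ≡ 2 + a * 3 → a < b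
b+c≡2+a*3⇒a<b {a} {b} {c} c<2b b+c≡ = *-cancelʳ-< 3 a b (begin-strict
  a * 3       <⟨ m<n+m (a * 3) z<s ⟩
  2 + a * 3   ≡⟨ sym b+c≡ ⟩
  b + c       <⟨ +-monoʳ-< b c<2b ⟩
  b + 2 * b   ≡⟨ b*3 b ⟩
  b * 3       ∎)
  where
  open ≤-Reasoning
  b*3 : ∀ b → b + 2 * b ≡ b * 3
  b*3 = solve-∀

2≤M+D : ∀ M D → 5 ≤ suc (M + double (M + D)) → 2 ≤ M + D
2≤M+D (suc (suc M)) D             _ = s≤s (s≤s z≤n)
2≤M+D 1             (suc D)       _ = s≤s (s≤s z≤n)
2≤M+D 0             (suc (suc D)) _ = s≤s (s≤s z≤n)
2≤M+D 1             0             (s≤s (s≤s (s≤s (s≤s ()))))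
2≤M+D 0             1             (s≤s (s≤s (s≤s ())))
2≤M+D 0             0             (s≤s ())

-- With b = a + 1 + M and c = b + D, the equation b + c = 3a + 2 says a = 2M + D.
offsets⇒parameters : ∀ a M D → suc a + M + (suc a + M + D) ≡ 2 + a * 3 → 5 ≤ suc a + M + D →
  ∃[ M' ] ∃[ N ] (2 ≤ N × a ≡ M' + N × suc a + M ≡ suc (double M' + N) × suc a + M + D ≡ suc (M' + double N))
offsets⇒parameters a M D b+c≡ 5≤c with +-cancelˡ-≡ (2 + a * 2) _ _ (trans (sym (lhs a M D)) (trans b+c≡ (rhs a)))
  where
  lhs : ∀ a M D → suc a + M + (suc a + M + D) ≡ 2 + a * 2 + (M + (M + D))
  lhs = solve-∀
  rhs : ∀ a → 2 + a * 3 ≡ 2 + a * 2 + a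
  rhs = solve-∀
... | refl = M , M + D , 2≤M+D M D (subst (5 ≤_) c≡ 5≤c) , refl , b≡ , c≡
  where
  b-+ : ∀ M D → suc (M + (M + D)) + M ≡ suc (M + M + (M + D))
  b-+ = solve-∀
  c-+ : ∀ M D → suc (M + (M + D)) + M + D ≡ suc (M + ((M + D) + (M + D)))
  c-+ = solve-∀
  b≡ : suc (M + (M + D)) + M ≡ suc (double M + (M + D))
  b≡ = trans (b-+ M D) (cong (λ t → suc (t + (M + D))) (sym (double≡+ M)))
  c≡ : suc (M + (M + D)) + M + D ≡ suc (M + double (M + D))
  c≡ = trans (c-+ M D) (cong (λ t → suc (M + t)) (sym (double≡+ (M + D))))

parametrise : ∀ {a b c} → b ≤ c → c < 2 * b → 5 ≤ c → (b + c) % 3 ≡ 2 → a ≡ (b + c ∸ 2) / 3 →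
  ∃[ M ] ∃[ N ] (2 ≤ N × a ≡ M + N × b ≡ suc (double M + N) × c ≡ suc (M + double N))
parametrise {a} {b} {c} b≤c c<2b 5≤c b+c%3≡2 a≡ with %3≡2⇒≡2+a*3 (b + c) b+c%3≡2 a≡
... | b+c≡ with m≤n⇒∃[o]m+o≡n (b+c≡2+a*3⇒a<b {a} c<2b b+c≡) | m≤n⇒∃[o]m+o≡n b≤c
...   | M , refl | D , refl = offsets⇒parameters a M D b+c≡ 5≤c

twoBlocks-feasible : ∀ M N → 2 ≤ N →
  Feasible (M + N) (suc (double M + N)) (suc (M + double N)) (questions (M + N) (suc (double M + N)) (suc (M + double N)))
twoBlocks-feasible M (suc K) 2≤N =
  subst (Feasible (M + suc K) (suc (double M + suc K)) (suc (M + double (suc K)))) (sym (questions-twoBlocks M K))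
        (feasible-intro (λ _ → twoBlocks-inRange M (suc K)) (twoBlocks-separate 2≤N))

lemma9 : (a b c : ℕ) → b ≤ c → c < 2 * b → 5 ≤ c → (b + c) % 3 ≡ 2 →
           a ≡ (b + c ∸ 2) / 3 →
           Feasible a b c (questions a b c)
lemma9 a b c b≤c c<2b 5≤c b+c%3≡2 a≡ with parametrise b≤c c<2b 5≤c b+c%3≡2 a≡
... | M , N , 2≤N , refl , refl , refl = twoBlocks-feasible M N 2≤N
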